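{- Let $k\ge 2$ and $n$ be positive integers, and let $\mathcal{G}$ be the Grundy function of the Maximum Nim with rule function $f(x)=\left\lfloor \frac{x}{k}\right\rfloor$. Then for every integer $m$ with $1\le m\le n$, $$JJ_k(n,m)=\mathcal{G}(nk-m).$$
   Context: Here $\lfloor y\rfloor$ denotes the greatest integer less than or equal to $y$. Maximum Nim with rule function $f$ is the following game. There is a single pile of stones. When the pile has $m$ stones, a move removes $u$ stones for some integer $u$ with $1\le u\le f(m)$. Two players alternate moves. The mex of a set of non-negative integers is the smallest non-negative integer not in it. The Grundy number is defined recursively by $\mathcal{G}(x)=\mathrm{mex}\{\mathcal{G}(x-u): u\in\mathbb{N},\ 1\le u\le \lfloor x/k\rfloor\}$ for $x\in\mathbb{Z}_{\ge 0}$. Josephus problem with step $k$: the integers $1,2,\dots,n$ are arranged clockwise in a circle. Counting starts at $1$, and every $k$-th number is removed. That is, the first number removed is the $k$-th counted, and after each removal counting resumes from the next remaining number, again removing the $k$-th counted. This continues until only one number remains. The remaining number is regarded as the $n$-th removed number. For $1\le m\le n$, $JJ_k(n,m)=n-i$, where $m$ is the $i$-th number removed, $1\le i\le n$. In particular, the survivor has $JJ_k(n,m)=0$. For example, with $n=10$ and $k=3$ the removal order is $3,6,9,2,7,1,8,5,10$ and $4$ survives. So $JJ_3(10,3)=9$, $JJ_3(10,10)=1$ and $JJ_3(10,4)=0$. -}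

module Defs where

open import Data.Nat using (ℕ; zero; suc; _∸_; _≟_; NonZero)
open import Data.Nat.DivMod using (_/_; _%_)
open import Data.List using (List; []; _∷_; length; take; drop; _++_; applyUpTo)
open import Data.Bool using (Bool; true; false; if_then_else_)
open import Relation.Nullary.Decidable using (does)

elem : ℕ → List ℕ → Bool
elem n []       = false
elem n (x ∷ xs) = if does (n ≟ x) then true else elem n xs

-- search upward from j with fuel; fuel (length + 1) suffices since mex ≤ length
mexFrom : ℕ → ℕ → List ℕ → ℕ
mexFrom zero     j l = j
mexFrom (suc f)  j l = if elem j l then mexFrom f (suc j) l else j

mex : List ℕ → ℕ
mex l = mexFrom (suc (length l)) 0 l

-- grundyTable k x = [G(x-1), G(x-2), …, G(0)]
grundyStep : (k : ℕ) → .{{NonZero k}} → ℕ → List ℕ → List ℕ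
grundyStep k x t = mex (take (x / k) t) ∷ t

grundyTable : (k : ℕ) → .{{NonZero k}} → ℕ → List ℕ
grundyTable k zero    = []
grundyTable k (suc x) = grundyStep k x (grundyTable k x)

-- G(x) = mex { G(x - u) : 1 ≤ u ≤ ⌊x/k⌋ }
-- (take (x / k) of [G(x-1),…,G(0)] is exactly [G(x-1),…,G(x-⌊x/k⌋)])
grundy : (k : ℕ) → .{{NonZero k}} → ℕ → ℕ
grundy k x = mex (take (x / k) (grundyTable k x))

nth : ℕ → List ℕ → ℕ
nth _       []       = 0
nth zero    (x ∷ xs) = x
nth (suc i) (x ∷ xs) = nth i xs

-- removalOrderFuel f k l : the circle l is listed clockwise starting at the
-- number where counting starts; returns the numbers in order of removal,
-- the last remaining number being listed last.
removalOrderFuel : ℕ → ℕ → List ℕ → List ℕ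
removalOrderFuel zero    k l                = l
removalOrderFuel (suc f) k []               = []
removalOrderFuel (suc f) k (x ∷ [])         = x ∷ []
removalOrderFuel (suc f) k l@(x ∷ y ∷ rest) =
  let i = (k ∸ 1) % suc (suc (length rest))
  in nth i l ∷ removalOrderFuel f k (drop (suc i) l ++ take i l)

removalOrder : ℕ → ℕ → List ℕ
removalOrder k n = removalOrderFuel n k (applyUpTo suc n)

-- 1-based position of m in a list (0 if absent)
position : ℕ → List ℕ → ℕ
position m []       = 0
position m (x ∷ xs) = if does (m ≟ x) then 1 else suc (position m xs)

JJ : ℕ → ℕ → ℕ → ℕ
JJ k n m = n ∸ position m (removalOrder k n)

-- Write x = q k + r with 0 ≤ r < k.  In Maximum Nim with f(x) = ⌊x/k⌋ the last
-- q values G(x-1), …, G(x-q) before a multiple x = q k form a permutation of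
-- {0, …, q-1}, so G(q k) = q, and inside a block (0 < r < k) the values
-- G(x-1), …, G(x-q-1) form a permutation of {0, …, q}, so G(x), the mex of the
-- first q of them, is the remaining one, G(x-q-1).  Hence G(q k + r) is periodic in r
-- with period q + 1.
--
-- On the Josephus side, with n people the first removal is at index
-- i = (k-1) mod n, and every other person moves to a circle of n-1 people.
-- Writing k = (i+1) + a n, the periodicity turns G(n k - j - 1) into N = n-1 for
-- j = i, and into G((n-1) k - j' - 1) for the new index j' of every other
-- person, which is exactly the recursion satisfied by JJ.

module Submission where

open import Defs
open import Data.Bool using (true; false)
open import Data.Empty using (⊥-elim)
open import Data.List using (List; []; _∷_; _∷ʳ_; length; take; drop; _++_; applyUpTo; upTo)
open import Data.List.Properties using (length-applyUpTo; length-upTo; upTo-∷ʳ; length-drop)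
open import Data.List.Membership.Propositional using (_∈_; _∉_)
open import Data.List.Membership.Propositional.Properties using (∈-upTo⁺; ∈-upTo⁻)
open import Data.List.Relation.Unary.Any using (here; there)
import Data.List.Relation.Unary.AllPairs as AllPairs
open import Data.List.Relation.Unary.Unique.Propositional using (Unique)
open import Data.List.Relation.Unary.Unique.Propositional.Properties
  using (upTo⁺; applyUpTo⁺₁; Unique[x∷xs]⇒x∉xs)
open import Data.List.Relation.Binary.Permutation.Propositional
  using (_↭_; prep; ↭-refl; ↭-sym; ↭-trans; ↭⇒↭ₛ)
open import Data.List.Relation.Binary.Permutation.Propositional.Properties
  using (∈-resp-↭; ↭-length; ∷↭∷ʳ; shift; ++-comm)
import Data.List.Relation.Binary.Permutation.Setoid.Properties as PermutationSetoid
open import Data.Nat using (ℕ; zero; suc; _+_; _*_; _∸_; _≤_; _<_; _≟_; NonZero; z≤n; s≤s; z<s; >-nonZero⁻¹)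
open import Data.Nat.Properties
open import Data.Nat.DivMod using (_/_; _%_; m%n<n; m≡m%n+[m/n]*n; m*n/n≡m; m<n⇒m/n≡0; +-distrib-/-∣ʳ)
open import Data.Nat.Divisibility using (n∣m*n)
open import Data.Nat.Tactic.RingSolver using (solve)
open import Data.Sum using (inj₁; inj₂)
open import Function using (_∘_)
open import Relation.Binary using (Tri; tri<; tri≈; tri>)
open import Relation.Binary.PropositionalEquality
open import Relation.Nullary.Decidable using (does; dec-true; dec-false)

open ≡-Reasoning

elem-∈ : ∀ {w l} → w ∈ l → elem w l ≡ true
elem-∈ {w} (here refl) rewrite dec-true (w ≟ w) refl = refl
elem-∈ {w} {x ∷ _} (there w∈l) with does (w ≟ x)
... | true  = refl
... | false = elem-∈ w∈l

elem-∉ : ∀ {w} l → w ∉ l → elem w l ≡ false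
elem-∉ []      _   = refl
elem-∉ {w} (x ∷ l) w∉ rewrite dec-false (w ≟ x) (w∉ ∘ here) = elem-∉ l (w∉ ∘ there)

position-head : ∀ v l → position v (v ∷ l) ≡ 1
position-head v l rewrite dec-true (v ≟ v) refl = refl

position-tail : ∀ {v a} l → v ≢ a → position v (a ∷ l) ≡ suc (position v l)
position-tail {v} {a} l v≢a rewrite dec-false (v ≟ a) v≢a = refl

mexFrom-≡ : ∀ {v l} f j → j ≤ v → v < j + f → (∀ {w} → w < v → w ∈ l) → v ∉ l →
            mexFrom f j l ≡ v
mexFrom-≡ zero j j≤v v<j+0 _ _ = ⊥-elim (<⇒≱ (subst (_ <_) (+-identityʳ j) v<j+0) j≤v)
mexFrom-≡ {v} {l} (suc f) j j≤v v<j+1+f below v∉l with m≤n⇒m<n∨m≡n j≤v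
... | inj₂ refl rewrite elem-∉ l v∉l = refl
... | inj₁ j<v  rewrite elem-∈ (below j<v) =
  mexFrom-≡ f (suc j) j<v (subst (v <_) (+-suc j f) v<j+1+f) below v∉l

mex-≡ : ∀ {v l} → v ≤ length l → (∀ {w} → w < v → w ∈ l) → v ∉ l → mex l ≡ v
mex-≡ v≤|l| below v∉l = mexFrom-≡ _ 0 z≤n (s≤s v≤|l|) below v∉l

unique-↭ : ∀ {xs ys : List ℕ} → xs ↭ ys → Unique xs → Unique ys
unique-↭ p = PermutationSetoid.Unique-resp-↭ (setoid ℕ) (↭⇒↭ₛ p)

mex-complement : ∀ {b l q} → b ∷ l ↭ upTo (suc q) → mex l ≡ b
mex-complement {b} {l} {q} p = mex-≡ b≤|l| below b∉l
  where
  b∉l : b ∉ l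
  b∉l = Unique[x∷xs]⇒x∉xs (unique-↭ (↭-sym p) (upTo⁺ (suc q)))
  b<1+q : b < suc q
  b<1+q = ∈-upTo⁻ (∈-resp-↭ p (here refl))
  q≡|l| : q ≡ length l
  q≡|l| = suc-injective (trans (sym (length-upTo (suc q))) (sym (↭-length p)))
  b≤|l| : b ≤ length l
  b≤|l| = subst (b ≤_) q≡|l| (≤-pred b<1+q)
  below : ∀ {w} → w < b → w ∈ l
  below w<b with ∈-resp-↭ (↭-sym p) (∈-upTo⁺ (<-trans w<b b<1+q))
  ... | here w≡b  = ⊥-elim (<⇒≢ w<b w≡b)
  ... | there w∈l = w∈l

upTo-suc-↭ : ∀ {l q} → l ↭ upTo q → q ∷ l ↭ upTo (suc q)
upTo-suc-↭ {l} {q} p = subst (q ∷ l ↭_) (upTo-∷ʳ q) (↭-trans (prep q p) (∷↭∷ʳ q (upTo q)))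

nth-∈ : ∀ j (l : List ℕ) → j < length l → nth j l ∈ l
nth-∈ zero    (x ∷ l) _          = here refl
nth-∈ (suc j) (x ∷ l) (s≤s j<|l|) = there (nth-∈ j l j<|l|)

nth-take : ∀ {j i} (l : List ℕ) → j < i → nth j (take i l) ≡ nth j l
nth-take {i = suc i} []      _ = refl
nth-take {zero}  {suc i} (x ∷ l) _          = refl
nth-take {suc j} {suc i} (x ∷ l) (s≤s j<i) = nth-take l j<i

nth-++ˡ : ∀ t (l l′ : List ℕ) → t < length l → nth t (l ++ l′) ≡ nth t l
nth-++ˡ zero    (x ∷ l) l′ _          = refl
nth-++ˡ (suc t) (x ∷ l) l′ (s≤s t<|l|) = nth-++ˡ t l l′ t<|l|

nth-++ʳ : ∀ j (l l′ : List ℕ) → nth (length l + j) (l ++ l′) ≡ nth j l′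
nth-++ʳ j []      l′ = refl
nth-++ʳ j (x ∷ l) l′ = nth-++ʳ j l l′

nth-drop-++ : ∀ d t (l l′ : List ℕ) → d + t < length l → nth (d + t) l ≡ nth t (drop d l ++ l′)
nth-drop-++ zero    t l       l′ t<|l|     = sym (nth-++ˡ t l l′ t<|l|)
nth-drop-++ (suc d) t (x ∷ l) l′ (s≤s lt) = nth-drop-++ d t l l′ lt

take-suc-nth : ∀ q (l : List ℕ) → q < length l → take (suc q) l ≡ take q l ∷ʳ nth q l
take-suc-nth zero    (x ∷ l) _          = refl
take-suc-nth (suc q) (x ∷ l) (s≤s q<|l|) = cong (x ∷_) (take-suc-nth q l q<|l|)

take-suc-↭ : ∀ {q} {l : List ℕ} → q < length l → nth q l ∷ take q l ↭ take (suc q) l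
take-suc-↭ {q} {l} q<|l| =
  subst (nth q l ∷ take q l ↭_) (sym (take-suc-nth q l q<|l|)) (∷↭∷ʳ (nth q l) (take q l))

split-at : ∀ i (l : List ℕ) → i < length l → take i l ++ nth i l ∷ drop (suc i) l ≡ l
split-at zero    (x ∷ l) _          = refl
split-at (suc i) (x ∷ l) (s≤s i<|l|) = cong (x ∷_) (split-at i l i<|l|)

nth-applyUpTo : ∀ (f : ℕ → ℕ) n j → j < n → nth j (applyUpTo f n) ≡ f j
nth-applyUpTo f (suc n) zero    _        = refl
nth-applyUpTo f (suc n) (suc j) (s≤s j<n) = nth-applyUpTo (f ∘ suc) n j j<n

-- The circle left after removing index i, listed from the next person on.
rotate : ℕ → List ℕ → List ℕ
rotate i l = drop (suc i) l ++ take i l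

rotate-↭ : ∀ i (l : List ℕ) → i < length l → l ↭ nth i l ∷ rotate i l
rotate-↭ i l i<|l| =
  subst (_↭ nth i l ∷ rotate i l) (split-at i l i<|l|)
    (↭-trans (shift (nth i l) (take i l) (drop (suc i) l))
             (prep (nth i l) (++-comm (take i l) (drop (suc i) l))))

nth-rotate-before : ∀ {i j} (l : List ℕ) → j < i →
                    nth j l ≡ nth (length (drop (suc i) l) + j) (rotate i l)
nth-rotate-before {i} {j} l j<i = sym (trans (nth-++ʳ j (drop (suc i) l) (take i l)) (nth-take l j<i))

nth-rotate-after : ∀ i t (l : List ℕ) → suc i + t < length l → nth (suc i + t) l ≡ nth t (rotate i l)
nth-rotate-after i t l = nth-drop-++ (suc i) t l (take i l)

m+[1+n]≡o⇒m<o : ∀ {m n o} → m + suc n ≡ o → m < o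
m+[1+n]≡o⇒m<o {m} refl = m<m+n m z<s

module Grundy (k : ℕ) .{{_ : NonZero k}} where

  G : ℕ → ℕ
  G = grundy k

  table : ℕ → List ℕ
  table = grundyTable k

  length-table : ∀ x → length (table x) ≡ x
  length-table zero    = refl
  length-table (suc x) = cong suc (length-table x)

  nth-table : ∀ i z → nth i (table (suc (i + z))) ≡ G z
  nth-table zero    z = refl
  nth-table (suc i) z = nth-table i z

  k≡1+[k∸1] : k ≡ suc (k ∸ 1)
  k≡1+[k∸1] = sym (m+[n∸m]≡n (>-nonZero⁻¹ k))

  block-div : ∀ q {r} → r < k → (q * k + r) / k ≡ q
  block-div q {r} r<k = begin
    (q * k + r) / k    ≡⟨ cong (_/ k) (+-comm (q * k) r) ⟩
    (r + q * k) / k    ≡⟨ +-distrib-/-∣ʳ r (n∣m*n q) ⟩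
    r / k + q * k / k  ≡⟨ cong₂ _+_ (m<n⇒m/n≡0 r<k) (m*n/n≡m q k) ⟩
    q                  ∎

  block-end : ∀ q → q * k + suc (k ∸ 1) ≡ suc q * k
  block-end q = trans (cong (q * k +_) (sym k≡1+[k∸1])) (+-comm (q * k) k)

  q<block : ∀ q r → q < q * k + suc r
  q<block q r = ≤-<-trans (m≤m*n q k) (m<m+n (q * k) z<s)

  Window : ℕ → ℕ → Set
  Window x L = take L (table x) ↭ upTo L

  grundy-complement : ∀ {x q b} → x / k ≡ q → b ∷ take q (table x) ↭ upTo (suc q) → G x ≡ b
  grundy-complement {x} x/k≡q p =
    trans (cong (λ t → mex (take t (table x))) x/k≡q) (mex-complement p)

  window-extend : ∀ {x q b} → x / k ≡ q → b ∷ take q (table x) ↭ upTo (suc q) →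
                  Window (suc x) (suc q)
  window-extend {x} {q} x/k≡q p =
    subst (λ g → g ∷ take q (table x) ↭ upTo (suc q)) (sym (grundy-complement x/k≡q p)) p

  mutual
    window-multiple : ∀ q → Window (q * k) q
    window-multiple zero    = ↭-refl
    window-multiple (suc q) =
      subst (λ x → Window x (suc q)) (block-end q) (window-inside q (k ∸ 1) k∸1<k)
      where
      k∸1<k : k ∸ 1 < k
      k∸1<k = subst (k ∸ 1 <_) (sym k≡1+[k∸1]) ≤-refl

    window-inside : ∀ q r → r < k → Window (q * k + suc r) (suc q)
    window-inside q zero _ =
      subst (λ x → Window x (suc q)) (+-comm 1 (q * k))
        (window-extend (m*n/n≡m q k) (upTo-suc-↭ (window-multiple q)))
    window-inside q (suc r) 1+r<k =
      subst (λ x → Window x (suc q)) (sym (+-suc (q * k) (suc r)))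
        (window-extend (block-div q 1+r<k) (complement-inside q r 1+r<k))

    complement-inside : ∀ q r → suc r < k →
      nth q (table (q * k + suc r)) ∷ take q (table (q * k + suc r)) ↭ upTo (suc q)
    complement-inside q r 1+r<k =
      ↭-trans (take-suc-↭ (subst (q <_) (sym (length-table _)) (q<block q r)))
              (window-inside q r (<-trans (n<1+n r) 1+r<k))

  G-multiple : ∀ q → G (q * k) ≡ q
  G-multiple q = grundy-complement (m*n/n≡m q k) (upTo-suc-↭ (window-multiple q))

  G-step : ∀ q y → q * k < y + suc q → y + suc q < suc q * k → G (y + suc q) ≡ G y
  G-step q y lower upper = begin
    G (y + suc q)                 ≡⟨ cong G (sym e) ⟩
    G (q * k + suc r)             ≡⟨ grundy-complement (block-div q 1+r<k) (complement-inside q r 1+r<k) ⟩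
    nth q (table (q * k + suc r)) ≡⟨ cong (λ x → nth q (table x)) (trans e (+-comm y (suc q))) ⟩
    nth q (table (suc (q + y)))   ≡⟨ nth-table q y ⟩
    G y                           ∎
    where
    r = y + suc q ∸ suc (q * k)
    e : q * k + suc r ≡ y + suc q
    e = trans (+-suc (q * k) r) (m+[n∸m]≡n lower)
    1+r<k : suc r < k
    1+r<k = +-cancelˡ-< (q * k) (suc r) k (subst₂ _<_ (sym e) (+-comm k (q * k)) upper)

  G-period : ∀ q c y → q * k < y + suc q → y + c * suc q < suc q * k → G (y + c * suc q) ≡ G y
  G-period q zero    y _     _     = cong G (+-identityʳ y)
  G-period q (suc c) y lower upper = begin
    G (y + (suc q + c * suc q)) ≡⟨ cong G (sym (+-assoc y (suc q) (c * suc q))) ⟩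
    G (y + suc q + c * suc q)   ≡⟨ G-period q c (y + suc q) (<-≤-trans lower (m≤m+n _ (suc q))) upper′ ⟩
    G (y + suc q)               ≡⟨ G-step q y lower (≤-<-trans (m≤m+n (y + suc q) (c * suc q)) upper′) ⟩
    G y                         ∎
    where
    upper′ : y + suc q + c * suc q < suc q * k
    upper′ = subst (_< suc q * k) (sym (+-assoc y (suc q) (c * suc q))) upper

  below-next-multiple : ∀ {N j y} → j < N → y + suc j ≡ N * k → N * k < y + suc N
  below-next-multiple {N} {y = y} j<N hy = subst (_< y + suc N) hy (+-monoʳ-< y (s≤s j<N))

  G-shift : ∀ {q c x y j} → x ≡ y + c * suc q → q * k < y + suc q → x + suc j ≡ suc q * k → G x ≡ G y
  G-shift {q} {c} {y = y} refl lower hx = G-period q c y lower (m+[1+n]≡o⇒m<o hx)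

  -- The three cases of the Josephus recursion, k = (i+1) + a (N+1): the removed
  -- index i, an index j < i (new index e + j), an index i+1+t (new index t).
  G-removed : ∀ {N i a x} → k ≡ suc i + a * suc N → x + suc i ≡ suc N * k → G x ≡ N
  G-removed {N} {i} {a} {x} ek hx = trans (G-shift {c = a} x≡ (m<m+n (N * k) z<s) hx) (G-multiple N)
    where
    x≡ : x ≡ N * k + a * suc N
    x≡ = +-cancelʳ-≡ (suc i) x _ (begin
      x + suc i                 ≡⟨ hx ⟩
      k + N * k                 ≡⟨ cong (_+ N * k) ek ⟩
      suc i + a * suc N + N * k ≡⟨ solve (i ∷ a ∷ N ∷ k ∷ []) ⟩
      N * k + a * suc N + suc i ∎)

  G-before : ∀ {N i a e j x y} → k ≡ suc i + a * suc N → N ≡ i + e → j < i →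
             x + suc j ≡ suc N * k → y + suc (e + j) ≡ N * k → G x ≡ G y
  G-before {N} {i} {a} {e} {j} {x} {y} ek N≡i+e j<i hx hy =
    G-shift {c = suc a} x≡ (below-next-multiple e+j<N hy) hx
    where
    e+j<N : e + j < N
    e+j<N = subst (e + j <_) (trans (+-comm e i) (sym N≡i+e)) (+-monoʳ-< e j<i)
    x≡ : x ≡ y + suc a * suc N
    x≡ = +-cancelʳ-≡ (suc j) x _ (begin
      x + suc j                             ≡⟨ hx ⟩
      k + N * k                             ≡⟨ cong₂ _+_ ek (sym hy) ⟩
      suc i + a * suc N + (y + suc (e + j)) ≡⟨ solve (i ∷ a ∷ N ∷ y ∷ e ∷ j ∷ []) ⟩
      y + (suc (i + e) + a * suc N) + suc j ≡⟨ cong (λ m → y + (suc m + a * suc N) + suc j) (sym N≡i+e) ⟩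
      y + suc a * suc N + suc j             ∎)

  G-after : ∀ {N i a t x y} → k ≡ suc i + a * suc N → t < N →
            x + suc (suc i + t) ≡ suc N * k → y + suc t ≡ N * k → G x ≡ G y
  G-after {N} {i} {a} {t} {x} {y} ek t<N hx hy =
    G-shift {c = a} x≡ (below-next-multiple t<N hy) hx
    where
    x≡ : x ≡ y + a * suc N
    x≡ = +-cancelʳ-≡ (suc (suc i + t)) x _ (begin
      x + suc (suc i + t)             ≡⟨ hx ⟩
      k + N * k                       ≡⟨ cong₂ _+_ ek (sym hy) ⟩
      suc i + a * suc N + (y + suc t) ≡⟨ solve (i ∷ a ∷ N ∷ y ∷ t ∷ []) ⟩
      y + a * suc N + suc (suc i + t) ∎)

module Josephus (k : ℕ) .{{_ : NonZero k}} where
  open Grundy k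

  N*k∸[1+j]+[1+j]≡N*k : ∀ {N j} → j < N → N * k ∸ suc j + suc j ≡ N * k
  N*k∸[1+j]+[1+j]≡N*k {N} j<N = m∸n+n≡m (≤-trans j<N (m≤m*n N k))

  removal-step : ∀ {N i a} (l R : List ℕ) → length l ≡ suc N → Unique l → i < suc N →
    k ≡ suc i + a * suc N →
    (∀ {j y} → j < N → y + suc j ≡ N * k → N ∸ position (nth j (rotate i l)) R ≡ G y) →
    ∀ {j x} → j < suc N → x + suc j ≡ suc N * k →
    suc N ∸ position (nth j l) (nth i l ∷ R) ≡ G x
  removal-step {N} {i} {a} l R |l|≡1+N u i<1+N ek rank-rest {j} {x} j<1+N hx = by-position (<-cmp j i)
    where
    rot : l ↭ nth i l ∷ rotate i l
    rot = rotate-↭ i l (subst (i <_) (sym |l|≡1+N) i<1+N)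

    survivor : ∀ {j′} → j′ < N → nth j l ≡ nth j′ (rotate i l) →
               suc N ∸ position (nth j l) (nth i l ∷ R) ≡ G (N * k ∸ suc j′)
    survivor {j′} j′<N eq = begin
      suc N ∸ position (nth j l) (nth i l ∷ R) ≡⟨ cong (suc N ∸_) (position-tail R j≢i) ⟩
      N ∸ position (nth j l) R                 ≡⟨ cong (λ v → N ∸ position v R) eq ⟩
      N ∸ position (nth j′ (rotate i l)) R     ≡⟨ rank-rest j′<N (N*k∸[1+j]+[1+j]≡N*k j′<N) ⟩
      G (N * k ∸ suc j′)                       ∎
      where
      j′<|l′| : j′ < length (rotate i l)
      j′<|l′| = subst (j′ <_) (suc-injective (trans (sym |l|≡1+N) (↭-length rot))) j′<N
      j≢i : nth j l ≢ nth i l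
      j≢i same = Unique[x∷xs]⇒x∉xs (unique-↭ rot u)
                   (subst (_∈ rotate i l) (trans (sym eq) same) (nth-∈ j′ _ j′<|l′|))

    by-position : Tri (j < i) (j ≡ i) (i < j) → suc N ∸ position (nth j l) (nth i l ∷ R) ≡ G x
    by-position (tri≈ _ j≡i _) = begin
      suc N ∸ position (nth j l) (nth i l ∷ R) ≡⟨ cong (λ m → suc N ∸ position (nth m l) R′) j≡i ⟩
      suc N ∸ position (nth i l) (nth i l ∷ R) ≡⟨ cong (suc N ∸_) (position-head (nth i l) R) ⟩
      N                                        ≡⟨ G-removed {a = a} ek hx′ ⟨
      G x                                      ∎
      where
      R′ = nth i l ∷ R
      hx′ : x + suc i ≡ suc N * k
      hx′ = subst (λ m → x + suc m ≡ suc N * k) j≡i hx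
    by-position (tri< j<i _ _) =
      trans (survivor e+j<N (nth-rotate-before l j<i))
            (sym (G-before {a = a} ek N≡i+e j<i hx (N*k∸[1+j]+[1+j]≡N*k e+j<N)))
      where
      e = length (drop (suc i) l)
      N≡i+e : N ≡ i + e
      N≡i+e = sym (trans (cong (i +_) (trans (length-drop (suc i) l) (cong (_∸ suc i) |l|≡1+N)))
                         (m+[n∸m]≡n (≤-pred i<1+N)))
      e+j<N : e + j < N
      e+j<N = subst (e + j <_) (trans (+-comm e i) (sym N≡i+e)) (+-monoʳ-< e j<i)
    by-position (tri> _ _ i<j) =
      trans (survivor t<N (trans (cong (λ m → nth m l) (sym 1+i+t≡j))
                                 (nth-rotate-after i t l (subst (_< length l) (sym 1+i+t≡j)
                                                           (subst (j <_) (sym |l|≡1+N) j<1+N)))))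
            (sym (G-after {a = a} ek t<N (subst (λ m → x + suc m ≡ suc N * k) (sym 1+i+t≡j) hx)
                                 (N*k∸[1+j]+[1+j]≡N*k t<N)))
      where
      t = j ∸ suc i
      1+i+t≡j : suc i + t ≡ j
      1+i+t≡j = m+[n∸m]≡n i<j
      t<N : t < N
      t<N = ≤-<-trans (m≤n+m t i) (≤-pred (subst (_< suc N) (sym 1+i+t≡j) j<1+N))

  josephus-grundy : ∀ N (l : List ℕ) → length l ≡ suc N → Unique l →
    ∀ {j x} → j < suc N → x + suc j ≡ suc N * k →
    suc N ∸ position (nth j l) (removalOrderFuel (suc N) k l) ≡ G x
  josephus-grundy zero    []            ()
  josephus-grundy zero    l@(_ ∷ [])    refl u =
    removal-step {a = k ∸ 1} l [] refl u z<s
      (trans k≡1+[k∸1] (cong suc (sym (*-identityʳ (k ∸ 1))))) (λ ())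
  josephus-grundy zero    (_ ∷ _ ∷ _)   ()
  josephus-grundy (suc _) []            ()
  josephus-grundy (suc _) (_ ∷ [])      ()
  josephus-grundy (suc N) l@(_ ∷ _ ∷ _) |l|≡2+N u =
    removal-step {a = (k ∸ 1) / length l} l (removalOrderFuel (suc N) k (rotate i l)) |l|≡2+N u
      (subst (i <_) |l|≡2+N (m%n<n (k ∸ 1) (length l)))
      (trans k≡1+[k∸1] (cong suc (trans (m≡m%n+[m/n]*n (k ∸ 1) (length l))
                                         (cong (λ n → i + (k ∸ 1) / length l * n) |l|≡2+N))))
      (josephus-grundy N (rotate i l) (suc-injective (trans (sym (↭-length rot)) |l|≡2+N))
                       (AllPairs.tail (unique-↭ rot u)))
    where
    i = (k ∸ 1) % length l
    rot : l ↭ nth i l ∷ rotate i l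
    rot = rotate-↭ i l (m%n<n (k ∸ 1) (length l))

mainTheorem2 : (k n : ℕ) .{{_ : NonZero k}} → 2 ≤ k → 1 ≤ n →
    (m : ℕ) → 1 ≤ m → m ≤ n →
    JJ k n m ≡ grundy k (n * k ∸ m)
mainTheorem2 k n@(suc N) _ _ (suc j) _ m≤n = begin
  n ∸ position (suc j) (removalOrder k n)
    ≡⟨ cong (λ v → n ∸ position v (removalOrder k n)) (sym (nth-applyUpTo suc n j m≤n)) ⟩
  n ∸ position (nth j circle) (removalOrderFuel n k circle)
    ≡⟨ josephus-grundy N circle (length-applyUpTo suc n) unique-circle m≤n
                       (m∸n+n≡m (≤-trans m≤n (m≤m*n n k))) ⟩
  grundy k (n * k ∸ suc j) ∎
  where
  open Josephus k
  circle = applyUpTo suc n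
  unique-circle : Unique circle
  unique-circle = applyUpTo⁺₁ suc n (λ i<j _ → <⇒≢ (s≤s i<j))
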